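{- Let $a,b,c$ be indeterminates and $n$ a positive integer. The three polynomials $(a-q^n)(1-aq^n)$, $(b-q^n)(1-bcq^n)$ and $(c-q^n)$ in $q$ are pairwise relatively prime, and \begin{align*} &\frac{(b-q^{n})(1-bcq^{n})(c-q^{n})(x-yq^{n})}{(a-b)(a-c)(a-bc)(1-ab)(1-ac)(1-abc)}\equiv1\pmod{(a-q^{n})(1-aq^{n})},\\ &\frac{(a-q^{n})(1-aq^{n})(c-q^{n})(u-vq^{n})}{(a-b)(b-c)(a-bc)(1-ab)(1-abc)(1-bc^2)}\equiv1\pmod{(b-q^{n})(1-bcq^{n})},\\ &\frac{(a-q^{n})(1-aq^{n})(b-q^{n})(1-bcq^{n})}{(a-c)(b-c)(1-ac)(1-bc^2)}\equiv1\pmod{(c-q^n)}, \end{align*} where \begin{align*} x&=a(1+a^2+a^4)(1+b^2c+bc^2)-a^2(1+a^2)(b+c+bc+b^2c^2)-bc(1-a^3+a^6),\\ y&=a^2(1+a^2)(1+b^2c+bc^2)-a^3(b+c+bc+b^2c^2)-abc(1+a^4),\\ u&=-a\{1+bc(b-c+bc+b^3c-b^2c^2+b^3c^2+b^5c^2-b^2c^3-b^4c^3)\}+bc(1+a^2)(1+b^2c-bc^2+b^4c^2-b^3c^3),\\ v&=-abc(1+b^2c-bc^2+b^2c^2+b^4c^2-b^3c^3)+b^2c^2(1+a^2)(1+b^2c-bc^2). \end{align*}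
   Context: Congruences are in the ring of polynomials in $q$ with coefficients in the field $\mathbb{Q}(a,b,c)$ of rational functions: $A\equiv B\pmod{P}$ means $P$ divides $A-B$ in that ring. -}

module Defs where

-- Conventions:
--  * A polynomial over a raw ring R is a list of coefficients (constant term first);
--    equality is coefficientwise up to trailing zero coefficients.
--  * Z[a,b,c] is built as ((Z[c])[b])[a]; Q(a,b,c) is its field of fractions, with
--    elements num / (d1 * ... * dk) where every factor di is a NONZERO polynomial.
--    (Fractions with integer numerators/denominators over Z[a,b,c] give exactly Q(a,b,c).)
--  * The ring of the paper is K[q] with K = Q(a,b,c).

open import Level using (0ℓ)
open import Algebra.Bundles.Raw using (RawRing)
open import Data.List.Base using (List; []; _∷_; map; foldr; _++_)
open import Data.Product.Base using (Σ; _,_; proj₁; _×_)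
open import Data.Nat.Base using (ℕ; zero; suc)
open import Data.Integer.Base using (ℤ; +-*-rawRing)
import Data.Integer.Properties as ℤP
open import Relation.Nullary using (¬_; Dec; yes; no)
open import Relation.Nullary.Decidable using (False; toWitnessFalse)
open import Relation.Binary.PropositionalEquality using (_≡_)

module PolyRing (R : RawRing 0ℓ 0ℓ) where
  open RawRing R

  Poly : Set
  Poly = List Carrier

  infix 4 _≈P_
  data _≈P_ : Poly → Poly → Set where
    []≈[] : [] ≈P []
    []≈∷  : ∀ {y ys} → y ≈ 0# → [] ≈P ys → [] ≈P (y ∷ ys)
    ∷≈[]  : ∀ {x xs} → x ≈ 0# → xs ≈P [] → (x ∷ xs) ≈P []
    ∷≈∷   : ∀ {x xs y ys} → x ≈ y → xs ≈P ys → (x ∷ xs) ≈P (y ∷ ys)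

  infixl 6 _+P_
  _+P_ : Poly → Poly → Poly
  [] +P ys = ys
  (x ∷ xs) +P [] = x ∷ xs
  (x ∷ xs) +P (y ∷ ys) = (x + y) ∷ (xs +P ys)

  -P_ : Poly → Poly
  -P xs = map -_ xs

  infixl 7 _*P_
  _*P_ : Poly → Poly → Poly
  [] *P ys = []
  (x ∷ xs) *P ys = map (x *_) ys +P (0# ∷ (xs *P ys))

  polyRawRing : RawRing 0ℓ 0ℓ
  polyRawRing = record
    { Carrier = Poly ; _≈_ = _≈P_ ; _+_ = _+P_ ; _*_ = _*P_ ; -_ = -P_
    ; 0# = [] ; 1# = 1# ∷ [] }

  X : Poly
  X = 0# ∷ 1# ∷ []

  const : Carrier → Poly
  const k = k ∷ []

  decZero : ((x : Carrier) → Dec (x ≈ 0#)) → (p : Poly) → Dec (p ≈P [])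
  decZero d [] = yes []≈[]
  decZero d (x ∷ xs) with d x | decZero d xs
  ... | yes e | yes es = yes (∷≈[] e es)
  ... | no ¬e | _ = no λ { (∷≈[] e _) → ¬e e }
  ... | yes _ | no ¬es = no λ { (∷≈[] _ es) → ¬es es }

module Fractions (R : RawRing 0ℓ 0ℓ) where
  open RawRing R

  NonZero : Set
  NonZero = Σ Carrier (λ d → ¬ (d ≈ 0#))

  prod : List NonZero → Carrier
  prod = foldr (λ d acc → proj₁ d * acc) 1#

  record Frac : Set where
    constructor _/_
    field
      num  : Carrier
      dens : List NonZero
  open Frac public

  infix 4 _≈F_
  _≈F_ : Frac → Frac → Set
  p ≈F r = num p * prod (dens r) ≈ num r * prod (dens p)

  _+F_ : Frac → Frac → Frac
  p +F r = (num p * prod (dens r) + num r * prod (dens p)) / (dens p ++ dens r)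

  _*F_ : Frac → Frac → Frac
  p *F r = (num p * num r) / (dens p ++ dens r)

  -F_ : Frac → Frac
  -F p = (- num p) / dens p

  fracRawRing : RawRing 0ℓ 0ℓ
  fracRawRing = record
    { Carrier = Frac ; _≈_ = _≈F_ ; _+_ = _+F_ ; _*_ = _*F_ ; -_ = -F_
    ; 0# = 0# / [] ; 1# = 1# / [] }

module Zc  = PolyRing +-*-rawRing
module Zbc = PolyRing Zc.polyRawRing
module Z3  = PolyRing Zbc.polyRawRing

Z3-rawRing : RawRing 0ℓ 0ℓ
Z3-rawRing = Z3.polyRawRing

ℤ[a,b,c] : Set
ℤ[a,b,c] = RawRing.Carrier Z3-rawRing

decZ3 : (p : ℤ[a,b,c]) → Dec (p Z3.≈P [])
decZ3 = Z3.decZero (Zbc.decZero (Zc.decZero (λ x → x ℤP.≟ RawRing.0# +-*-rawRing)))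

module FK = Fractions Z3-rawRing

K-rawRing : RawRing 0ℓ 0ℓ
K-rawRing = FK.fracRawRing

module Kq = PolyRing K-rawRing

Kq-rawRing : RawRing 0ℓ 0ℓ
Kq-rawRing = Kq.polyRawRing

K[q] : Set
K[q] = Kq.Poly

open RawRing Kq-rawRing public
  using ()
  renaming (_≈_ to _≈q_; _+_ to _⊕_; _*_ to _⊗_; -_ to ⊖_; 0# to 𝟘; 1# to 𝟙)

infixl 6 _⊝_
_⊝_ : K[q] → K[q] → K[q]
f ⊝ g = f ⊕ (⊖ g)

infixr 8 _^_
_^_ : K[q] → ℕ → K[q]
f ^ zero = 𝟙
f ^ suc n = f ⊗ (f ^ n)

infix 4 _∣q_
_∣q_ : K[q] → K[q] → Set
d ∣q f = Σ K[q] (λ h → f ≈q d ⊗ h)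

IsUnit : K[q] → Set
IsUnit u = u ∣q 𝟙

RelPrime : K[q] → K[q] → Set
RelPrime f g = (d : K[q]) → d ∣q f → d ∣q g → IsUnit d

infix 4 _≡_[mod_]
_≡_[mod_] : K[q] → K[q] → K[q] → Set
A ≡ B [mod P ] = P ∣q (A ⊝ B)

ι : ℤ[a,b,c] → K[q]
ι z = Kq.const (z FK./ [])

za zb zc : ℤ[a,b,c]
za = Z3.X
zb = Z3.const Zbc.X
zc = Z3.const (Zbc.const Zc.X)

a b c q : K[q]
a = ι za
b = ι zb
c = ι zc
q = Kq.X

nz : (d : ℤ[a,b,c]) → {e : ¬ (d Z3.≈P [])} → FK.NonZero
nz d {e} = d , e

nz! : (d : ℤ[a,b,c]) → {p : False (decZ3 d)} → FK.NonZero
nz! d {p} = nz d {toWitnessFalse p}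

inv : List FK.NonZero → K[q]
inv ds = Kq.const (RawRing.1# Z3-rawRing FK./ ds)

private
  open RawRing Z3-rawRing using () renaming (_+_ to _+z_; _*_ to _*z_; -_ to -z_; 1# to 1z)
  infixl 6 _-z_
  _-z_ : ℤ[a,b,c] → ℤ[a,b,c] → ℤ[a,b,c]
  x -z y = x +z (-z y)

dens₁ dens₂ dens₃ : List FK.NonZero
dens₁ = nz! (za -z zb) ∷ nz! (za -z zc)
      ∷ nz! (za -z zb *z zc) ∷ nz! (1z -z za *z zb)
      ∷ nz! (1z -z za *z zc) ∷ nz! (1z -z za *z zb *z zc) ∷ []
dens₂ = nz! (za -z zb) ∷ nz! (zb -z zc)
      ∷ nz! (za -z zb *z zc) ∷ nz! (1z -z za *z zb)
      ∷ nz! (1z -z za *z zb *z zc) ∷ nz! (1z -z zb *z zc *z zc) ∷ []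
dens₃ = nz! (za -z zc) ∷ nz! (zb -z zc)
      ∷ nz! (1z -z za *z zc) ∷ nz! (1z -z zb *z zc *z zc) ∷ []

x y u v : K[q]
x = a ⊗ (𝟙 ⊕ a ^ 2 ⊕ a ^ 4) ⊗ (𝟙 ⊕ b ^ 2 ⊗ c ⊕ b ⊗ c ^ 2)
    ⊝ a ^ 2 ⊗ (𝟙 ⊕ a ^ 2) ⊗ (b ⊕ c ⊕ b ⊗ c ⊕ b ^ 2 ⊗ c ^ 2)
    ⊝ b ⊗ c ⊗ (𝟙 ⊝ a ^ 3 ⊕ a ^ 6)
y = a ^ 2 ⊗ (𝟙 ⊕ a ^ 2) ⊗ (𝟙 ⊕ b ^ 2 ⊗ c ⊕ b ⊗ c ^ 2)
    ⊝ a ^ 3 ⊗ (b ⊕ c ⊕ b ⊗ c ⊕ b ^ 2 ⊗ c ^ 2)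
    ⊝ a ⊗ b ⊗ c ⊗ (𝟙 ⊕ a ^ 4)
u = ⊖ (a ⊗ (𝟙 ⊕ b ⊗ c ⊗ (b ⊝ c ⊕ b ⊗ c ⊕ b ^ 3 ⊗ c ⊝ b ^ 2 ⊗ c ^ 2 ⊕ b ^ 3 ⊗ c ^ 2
                          ⊕ b ^ 5 ⊗ c ^ 2 ⊝ b ^ 2 ⊗ c ^ 3 ⊝ b ^ 4 ⊗ c ^ 3)))
    ⊕ b ⊗ c ⊗ (𝟙 ⊕ a ^ 2) ⊗ (𝟙 ⊕ b ^ 2 ⊗ c ⊝ b ⊗ c ^ 2 ⊕ b ^ 4 ⊗ c ^ 2 ⊝ b ^ 3 ⊗ c ^ 3)
v = ⊖ (a ⊗ b ⊗ c ⊗ (𝟙 ⊕ b ^ 2 ⊗ c ⊝ b ⊗ c ^ 2 ⊕ b ^ 2 ⊗ c ^ 2 ⊕ b ^ 4 ⊗ c ^ 2 ⊝ b ^ 3 ⊗ c ^ 3))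
    ⊕ b ^ 2 ⊗ c ^ 2 ⊗ (𝟙 ⊕ a ^ 2) ⊗ (𝟙 ⊕ b ^ 2 ⊗ c ⊝ b ⊗ c ^ 2)

{-# OPTIONS --safe #-}
module Submission where

-- Write Q for q ^ n.  The moduli split into linear factors in Q,
--   a − Q,  1 − aQ = a (a⁻¹ − Q),  b − Q,  1 − bcQ = bc ((bc)⁻¹ − Q),  c − Q,
-- each a unit multiple of r − Q for a root r ∈ {a, a⁻¹, b, (bc)⁻¹, c}.  Any two of these
-- roots differ by a nonzero constant, i.e. a unit of K[q], and w (r − Q) − w (s − Q) = 1
-- for w = (r − s)⁻¹; so distinct factors are comaximal, which gives the coprimality.
-- Each left-hand side is a polynomial expression L in Q, and L(Q) ≡ L(r) modulo r − Q.
-- Hence a congruence L ≡ 1 modulo a product of comaximal linear factors follows from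
-- L(r) = 1 at their roots, five identities in Q(a,b,c) that are checked by evaluation.

open import Level using (0ℓ; _⊔_)
open import Algebra.Bundles using (AbelianGroup; CommutativeRing)
open import Algebra.Structures using (IsAbelianGroup; IsCommutativeRing)
import Algebra.Properties.CommutativeSemigroup as CommSemigroupProperties
import Algebra.Properties.Ring as RingProperties
import Algebra.Solver.Ring.NaturalCoefficients.Default as NaturalSolver
import Data.Integer.Properties as ℤ
open import Data.Empty using (⊥; ⊥-elim)
open import Data.List.Base using ([]; _∷_; _++_; map)
open import Data.Nat.Base using (ℕ; zero; suc; _≤_)
open import Data.Product.Base using (Σ; _×_; _,_; proj₂; uncurry)
open import Data.Sum.Base using (_⊎_; inj₁; inj₂; [_,_])
open import Function.Base using (id)
open import Relation.Binary.Definitions using (Decidable)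
import Relation.Binary.Reasoning.Setoid as SetoidReasoning
open import Relation.Nullary using (¬_; yes; no)
open import Relation.Nullary.Decidable using (False; map′; _×-dec_; from-yes; toWitnessFalse)
open import Defs using (module PolyRing; module Fractions)

Nontrivial : ∀ {c ℓ} → CommutativeRing c ℓ → Set ℓ
Nontrivial R = ¬ 1# ≈ 0#
  where open CommutativeRing R

NoZeroDivisors : ∀ {c ℓ} → CommutativeRing c ℓ → Set (c ⊔ ℓ)
NoZeroDivisors R = ∀ {x y} → x * y ≈ 0# → x ≈ 0# ⊎ y ≈ 0#
  where open CommutativeRing R

module Polynomials (R : CommutativeRing 0ℓ 0ℓ) where
  private module C = CommutativeRing R
  open C using (Carrier; _≈_; _+_; _*_; -_; 0#; 1#)
  open PolyRing C.rawRing

  -- _≈P_ ignores trailing zeros, so polynomial equalities are proved coefficientwise.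
  coeff : Poly → ℕ → Carrier
  coeff []       _       = 0#
  coeff (x ∷ xs) zero    = x
  coeff (x ∷ xs) (suc i) = coeff xs i

  ≈P⇒coeff : ∀ {xs ys} → xs ≈P ys → ∀ i → coeff xs i ≈ coeff ys i
  ≈P⇒coeff []≈[]       i       = C.refl
  ≈P⇒coeff ([]≈∷ e _)  zero    = C.sym e
  ≈P⇒coeff ([]≈∷ _ es) (suc i) = ≈P⇒coeff es i
  ≈P⇒coeff (∷≈[] e _)  zero    = e
  ≈P⇒coeff (∷≈[] _ es) (suc i) = ≈P⇒coeff es i
  ≈P⇒coeff (∷≈∷ e _)   zero    = e
  ≈P⇒coeff (∷≈∷ _ es)  (suc i) = ≈P⇒coeff es i

  coeff⇒≈P : ∀ {xs ys} → (∀ i → coeff xs i ≈ coeff ys i) → xs ≈P ys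
  coeff⇒≈P {[]}     {[]}     e = []≈[]
  coeff⇒≈P {[]}     {y ∷ ys} e = []≈∷ (C.sym (e zero)) (coeff⇒≈P (λ i → e (suc i)))
  coeff⇒≈P {x ∷ xs} {[]}     e = ∷≈[] (e zero) (coeff⇒≈P (λ i → e (suc i)))
  coeff⇒≈P {x ∷ xs} {y ∷ ys} e = ∷≈∷ (e zero) (coeff⇒≈P (λ i → e (suc i)))

  ≈P-refl : ∀ {xs} → xs ≈P xs
  ≈P-refl = coeff⇒≈P (λ _ → C.refl)

  ≈P-sym : ∀ {xs ys} → xs ≈P ys → ys ≈P xs
  ≈P-sym e = coeff⇒≈P (λ i → C.sym (≈P⇒coeff e i))

  ≈P-trans : ∀ {xs ys zs} → xs ≈P ys → ys ≈P zs → xs ≈P zs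
  ≈P-trans e f = coeff⇒≈P (λ i → C.trans (≈P⇒coeff e i) (≈P⇒coeff f i))

  infixr 7 _·_
  _·_ : Carrier → Poly → Poly
  k · ys = map (k *_) ys

  shift : Poly → Poly
  shift zs = 0# ∷ zs

  coeff-+P : ∀ xs ys i → coeff (xs +P ys) i ≈ coeff xs i + coeff ys i
  coeff-+P []       ys       i       = C.sym (C.+-identityˡ _)
  coeff-+P (x ∷ xs) []       i       = C.sym (C.+-identityʳ _)
  coeff-+P (x ∷ xs) (y ∷ ys) zero    = C.refl
  coeff-+P (x ∷ xs) (y ∷ ys) (suc i) = coeff-+P xs ys i

  coeff-negP : ∀ xs i → coeff (-P xs) i ≈ - coeff xs i
  coeff-negP []       i       = C.sym (RingProperties.-0#≈0# C.ring)
  coeff-negP (x ∷ xs) zero    = C.refl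
  coeff-negP (x ∷ xs) (suc i) = coeff-negP xs i

  coeff-· : ∀ k ys i → coeff (k · ys) i ≈ k * coeff ys i
  coeff-· k []       i       = C.sym (C.zeroʳ k)
  coeff-· k (y ∷ ys) zero    = C.refl
  coeff-· k (y ∷ ys) (suc i) = coeff-· k ys i

  +P-cong : ∀ {xs xs′ ys ys′} → xs ≈P xs′ → ys ≈P ys′ → xs +P ys ≈P xs′ +P ys′
  +P-cong {xs} {xs′} {ys} {ys′} e f = coeff⇒≈P λ i → C.trans (coeff-+P xs ys i)
    (C.trans (C.+-cong (≈P⇒coeff e i) (≈P⇒coeff f i)) (C.sym (coeff-+P xs′ ys′ i)))

  +P-congˡ : ∀ xs {ys ys′} → ys ≈P ys′ → xs +P ys ≈P xs +P ys′
  +P-congˡ xs = +P-cong (≈P-refl {xs})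

  +P-congʳ : ∀ {xs xs′} ys → xs ≈P xs′ → xs +P ys ≈P xs′ +P ys
  +P-congʳ ys e = +P-cong e (≈P-refl {ys})

  +P-assoc : ∀ xs ys zs → (xs +P ys) +P zs ≈P xs +P (ys +P zs)
  +P-assoc xs ys zs = coeff⇒≈P λ i → C.trans (coeff-+P (xs +P ys) zs i)
    (C.trans (C.+-congʳ (coeff-+P xs ys i)) (C.trans (C.+-assoc _ _ _)
    (C.trans (C.+-congˡ (C.sym (coeff-+P ys zs i))) (C.sym (coeff-+P xs (ys +P zs) i)))))

  +P-comm : ∀ xs ys → xs +P ys ≈P ys +P xs
  +P-comm xs ys = coeff⇒≈P λ i →
    C.trans (coeff-+P xs ys i) (C.trans (C.+-comm _ _) (C.sym (coeff-+P ys xs i)))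

  +P-identityʳ : ∀ xs → xs +P [] ≈P xs
  +P-identityʳ xs = coeff⇒≈P λ i → C.trans (coeff-+P xs [] i) (C.+-identityʳ _)

  -P-cong : ∀ {xs ys} → xs ≈P ys → -P xs ≈P -P ys
  -P-cong {xs} {ys} e = coeff⇒≈P λ i →
    C.trans (coeff-negP xs i) (C.trans (C.-‿cong (≈P⇒coeff e i)) (C.sym (coeff-negP ys i)))

  -P-inverseˡ : ∀ xs → (-P xs) +P xs ≈P []
  -P-inverseˡ xs = coeff⇒≈P λ i → C.trans (coeff-+P (-P xs) xs i)
    (C.trans (C.+-congʳ (coeff-negP xs i)) (C.-‿inverseˡ _))

  -P-inverseʳ : ∀ xs → xs +P (-P xs) ≈P []
  -P-inverseʳ xs = ≈P-trans (+P-comm xs (-P xs)) (-P-inverseˡ xs)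

  +P-isAbelianGroup : IsAbelianGroup _≈P_ _+P_ [] -P_
  +P-isAbelianGroup = record
    { isGroup = record
      { isMonoid = record
        { isSemigroup = record
          { isMagma = record
            { isEquivalence = record { refl = ≈P-refl ; sym = ≈P-sym ; trans = ≈P-trans }
            ; ∙-cong = +P-cong }
          ; assoc = +P-assoc }
        ; identity = (λ _ → ≈P-refl) , +P-identityʳ }
      ; inverse = -P-inverseˡ , -P-inverseʳ
      ; ⁻¹-cong = -P-cong }
    ; comm = +P-comm }

  +P-abelianGroup : AbelianGroup 0ℓ 0ℓ
  +P-abelianGroup = record { isAbelianGroup = +P-isAbelianGroup }

  open AbelianGroup +P-abelianGroup using (setoid; commutativeSemigroup)
  open CommSemigroupProperties commutativeSemigroup using (interchange; x∙yz≈y∙xz)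
  open SetoidReasoning setoid

  ·-cong : ∀ {k k′ ys ys′} → k ≈ k′ → ys ≈P ys′ → k · ys ≈P k′ · ys′
  ·-cong {k} {k′} {ys} {ys′} e f = coeff⇒≈P λ i → C.trans (coeff-· k ys i)
    (C.trans (C.*-cong e (≈P⇒coeff f i)) (C.sym (coeff-· k′ ys′ i)))

  ·-distribˡ : ∀ k ys zs → k · (ys +P zs) ≈P k · ys +P k · zs
  ·-distribˡ k ys zs = coeff⇒≈P λ i → C.trans (coeff-· k (ys +P zs) i)
    (C.trans (C.*-congˡ (coeff-+P ys zs i)) (C.trans (C.distribˡ _ _ _)
    (C.sym (C.trans (coeff-+P (k · ys) (k · zs) i) (C.+-cong (coeff-· k ys i) (coeff-· k zs i))))))

  ·-distribʳ : ∀ k l ys → (k + l) · ys ≈P k · ys +P l · ys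
  ·-distribʳ k l ys = coeff⇒≈P λ i → C.trans (coeff-· (k + l) ys i)
    (C.trans (C.distribʳ _ _ _)
    (C.sym (C.trans (coeff-+P (k · ys) (l · ys) i) (C.+-cong (coeff-· k ys i) (coeff-· l ys i)))))

  ·-assoc : ∀ k l ys → k · (l · ys) ≈P (k * l) · ys
  ·-assoc k l ys = coeff⇒≈P λ i → C.trans (coeff-· k (l · ys) i)
    (C.trans (C.*-congˡ (coeff-· l ys i)) (C.trans (C.sym (C.*-assoc _ _ _)) (C.sym (coeff-· (k * l) ys i))))

  ≈0⇒·≈[] : ∀ {k} ys → k ≈ 0# → k · ys ≈P []
  ≈0⇒·≈[] {k} ys e = coeff⇒≈P λ i → C.trans (coeff-· k ys i) (C.trans (C.*-congʳ e) (C.zeroˡ _))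

  ·-identityˡ : ∀ ys → 1# · ys ≈P ys
  ·-identityˡ ys = coeff⇒≈P λ i → C.trans (coeff-· 1# ys i) (C.*-identityˡ _)

  shift-cong : ∀ {xs ys} → xs ≈P ys → shift xs ≈P shift ys
  shift-cong = ∷≈∷ C.refl

  shift-+P : ∀ xs ys → shift (xs +P ys) ≈P shift xs +P shift ys
  shift-+P xs ys = ∷≈∷ (C.sym (C.+-identityˡ 0#)) ≈P-refl

  shift-[] : shift [] ≈P []
  shift-[] = ∷≈[] C.refl []≈[]

  ·-shift : ∀ k zs → k · shift zs ≈P shift (k · zs)
  ·-shift k zs = ∷≈∷ (C.zeroʳ k) ≈P-refl

  *P-congˡ : ∀ {xs xs′} ys → xs ≈P xs′ → xs *P ys ≈P xs′ *P ys
  *P-congˡ ys []≈[] = ≈P-refl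
  *P-congˡ ys ([]≈∷ {y} {xs} e es) = ≈P-sym (begin
    y · ys +P shift (xs *P ys) ≈⟨ +P-cong (≈0⇒·≈[] ys e) (shift-cong (≈P-sym (*P-congˡ ys es))) ⟩
    shift []                   ≈⟨ shift-[] ⟩
    []                         ∎)
  *P-congˡ ys (∷≈[] {x} {xs} e es) = begin
    x · ys +P shift (xs *P ys) ≈⟨ +P-cong (≈0⇒·≈[] ys e) (shift-cong (*P-congˡ ys es)) ⟩
    shift []                   ≈⟨ shift-[] ⟩
    []                         ∎
  *P-congˡ ys (∷≈∷ e es) = +P-cong (·-cong e ≈P-refl) (shift-cong (*P-congˡ ys es))

  *P-congʳ : ∀ xs {ys ys′} → ys ≈P ys′ → xs *P ys ≈P xs *P ys′
  *P-congʳ []       e = ≈P-refl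
  *P-congʳ (x ∷ xs) e = +P-cong (·-cong C.refl e) (shift-cong (*P-congʳ xs e))

  *P-cong : ∀ {xs xs′ ys ys′} → xs ≈P xs′ → ys ≈P ys′ → xs *P ys ≈P xs′ *P ys′
  *P-cong {xs′ = xs′} {ys} e f = ≈P-trans (*P-congˡ ys e) (*P-congʳ xs′ f)

  *P-distribʳ : ∀ zs xs ys → (xs +P ys) *P zs ≈P xs *P zs +P ys *P zs
  *P-distribʳ zs []       ys       = ≈P-refl
  *P-distribʳ zs (x ∷ xs) []       = ≈P-sym (+P-identityʳ _)
  *P-distribʳ zs (x ∷ xs) (y ∷ ys) = begin
    (x + y) · zs +P shift ((xs +P ys) *P zs)
      ≈⟨ +P-cong (·-distribʳ x y zs)
                 (≈P-trans (shift-cong (*P-distribʳ zs xs ys)) (shift-+P (xs *P zs) (ys *P zs))) ⟩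
    (x · zs +P y · zs) +P (shift (xs *P zs) +P shift (ys *P zs))
      ≈⟨ interchange (x · zs) (y · zs) (shift (xs *P zs)) (shift (ys *P zs)) ⟩
    (x · zs +P shift (xs *P zs)) +P (y · zs +P shift (ys *P zs)) ∎

  *P-distribˡ : ∀ xs ys zs → xs *P (ys +P zs) ≈P xs *P ys +P xs *P zs
  *P-distribˡ []       ys zs = ≈P-refl
  *P-distribˡ (x ∷ xs) ys zs = begin
    x · (ys +P zs) +P shift (xs *P (ys +P zs))
      ≈⟨ +P-cong (·-distribˡ x ys zs)
                 (≈P-trans (shift-cong (*P-distribˡ xs ys zs)) (shift-+P (xs *P ys) (xs *P zs))) ⟩
    (x · ys +P x · zs) +P (shift (xs *P ys) +P shift (xs *P zs))
      ≈⟨ interchange (x · ys) (x · zs) (shift (xs *P ys)) (shift (xs *P zs)) ⟩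
    (x · ys +P shift (xs *P ys)) +P (x · zs +P shift (xs *P zs)) ∎

  *P-zeroʳ : ∀ xs → xs *P [] ≈P []
  *P-zeroʳ []       = ≈P-refl
  *P-zeroʳ (x ∷ xs) = ≈P-trans (shift-cong (*P-zeroʳ xs)) shift-[]

  *P-∷ʳ : ∀ xs y ys → xs *P (y ∷ ys) ≈P y · xs +P shift (xs *P ys)
  *P-∷ʳ []       y ys = []≈∷ C.refl []≈[]
  *P-∷ʳ (x ∷ xs) y ys = ∷≈∷ (C.+-congʳ (C.*-comm x y)) (begin
    x · ys +P xs *P (y ∷ ys)                   ≈⟨ +P-cong ≈P-refl (*P-∷ʳ xs y ys) ⟩
    x · ys +P (y · xs +P shift (xs *P ys))     ≈⟨ x∙yz≈y∙xz (x · ys) (y · xs) (shift (xs *P ys)) ⟩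
    y · xs +P (x · ys +P shift (xs *P ys))     ∎)

  *P-comm : ∀ xs ys → xs *P ys ≈P ys *P xs
  *P-comm []       ys = ≈P-sym (*P-zeroʳ ys)
  *P-comm (x ∷ xs) ys = begin
    x · ys +P shift (xs *P ys) ≈⟨ +P-cong ≈P-refl (shift-cong (*P-comm xs ys)) ⟩
    x · ys +P shift (ys *P xs) ≈⟨ ≈P-sym (*P-∷ʳ ys x xs) ⟩
    ys *P (x ∷ xs)             ∎

  shift-*P : ∀ xs ys → shift xs *P ys ≈P shift (xs *P ys)
  shift-*P xs ys = +P-cong (≈0⇒·≈[] ys C.refl) ≈P-refl

  ·-*P : ∀ k xs ys → (k · xs) *P ys ≈P k · (xs *P ys)
  ·-*P k []       ys = ≈P-refl
  ·-*P k (x ∷ xs) ys = begin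
    (k * x) · ys +P shift ((k · xs) *P ys) ≈⟨ +P-cong (≈P-sym (·-assoc k x ys)) (shift-cong (·-*P k xs ys)) ⟩
    k · (x · ys) +P shift (k · (xs *P ys)) ≈⟨ +P-cong ≈P-refl (≈P-sym (·-shift k (xs *P ys))) ⟩
    k · (x · ys) +P k · shift (xs *P ys)   ≈⟨ ≈P-sym (·-distribˡ k (x · ys) (shift (xs *P ys))) ⟩
    k · (x · ys +P shift (xs *P ys))       ∎

  *P-assoc : ∀ xs ys zs → (xs *P ys) *P zs ≈P xs *P (ys *P zs)
  *P-assoc []       ys zs = ≈P-refl
  *P-assoc (x ∷ xs) ys zs = begin
    (x · ys +P shift (xs *P ys)) *P zs         ≈⟨ *P-distribʳ zs (x · ys) (shift (xs *P ys)) ⟩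
    (x · ys) *P zs +P shift (xs *P ys) *P zs   ≈⟨ +P-cong (·-*P x ys zs) (shift-*P (xs *P ys) zs) ⟩
    x · (ys *P zs) +P shift ((xs *P ys) *P zs) ≈⟨ +P-cong ≈P-refl (shift-cong (*P-assoc xs ys zs)) ⟩
    x · (ys *P zs) +P shift (xs *P (ys *P zs)) ∎

  *P-identityˡ : ∀ xs → (1# ∷ []) *P xs ≈P xs
  *P-identityˡ xs = ≈P-trans (+P-cong (·-identityˡ xs) shift-[]) (+P-identityʳ xs)

  *P-identityʳ : ∀ xs → xs *P (1# ∷ []) ≈P xs
  *P-identityʳ xs = ≈P-trans (*P-comm xs (1# ∷ [])) (*P-identityˡ xs)

  +P-*P-isCommutativeRing : IsCommutativeRing _≈P_ _+P_ _*P_ -P_ [] (1# ∷ [])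
  +P-*P-isCommutativeRing = record
    { isRing = record
      { +-isAbelianGroup = +P-isAbelianGroup
      ; *-cong = *P-cong
      ; *-assoc = *P-assoc
      ; *-identity = *P-identityˡ , *P-identityʳ
      ; distrib = *P-distribˡ , *P-distribʳ }
    ; *-comm = *P-comm }

  +P-*P-commutativeRing : CommutativeRing 0ℓ 0ℓ
  +P-*P-commutativeRing = record { isCommutativeRing = +P-*P-isCommutativeRing }

  1≈const-* : ∀ k l → k * l ≈ 1# → (1# ∷ []) ≈P (k ∷ []) *P (l ∷ [])
  1≈const-* k l kl≈1 = ∷≈∷ (C.sym (C.trans (C.+-identityʳ (k * l)) kl≈1)) []≈[]

  module _ (_≟_ : Decidable _≈_) where

    _≟P_ : Decidable _≈P_
    []       ≟P []       = yes []≈[]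
    []       ≟P (y ∷ ys) = map′ (uncurry []≈∷) (λ { ([]≈∷ e es) → e , es }) (y ≟ 0# ×-dec [] ≟P ys)
    (x ∷ xs) ≟P []       = map′ (uncurry ∷≈[]) (λ { (∷≈[] e es) → e , es }) (x ≟ 0# ×-dec xs ≟P [])
    (x ∷ xs) ≟P (y ∷ ys) = map′ (uncurry ∷≈∷) (λ { (∷≈∷ e es) → e , es }) (x ≟ y ×-dec xs ≟P ys)

    module _ (noZeroDivisors : NoZeroDivisors R) where

      private
        cancel-lowest : ∀ {x} → ¬ x ≈ 0# → ∀ xs ys → (x ∷ xs) *P ys ≈P [] → ys ≈P []
        cancel-lowest x≉0 xs []       _                 = []≈[]
        cancel-lowest {x} x≉0 xs (y ∷ ys) (∷≈[] xy+0≈0 rest) = ∷≈[] y≈0 (cancel-lowest x≉0 xs ys rest′)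
          where
          y≈0 : y ≈ 0#
          y≈0 = [ (λ x≈0 → ⊥-elim (x≉0 x≈0)) , id ]
                  (noZeroDivisors (C.trans (C.sym (C.+-identityʳ _)) xy+0≈0))
          rest′ : x · ys +P shift (xs *P ys) ≈P []
          rest′ = begin
            x · ys +P shift (xs *P ys)
              ≈⟨ +P-congˡ (x · ys) (+P-congʳ (shift (xs *P ys)) (≈P-sym (≈0⇒·≈[] xs y≈0))) ⟩
            x · ys +P (y · xs +P shift (xs *P ys))
              ≈⟨ +P-congˡ (x · ys) (≈P-sym (*P-∷ʳ xs y ys)) ⟩
            x · ys +P xs *P (y ∷ ys)
              ≈⟨ rest ⟩
            [] ∎

        cancel : ∀ xs → ¬ xs ≈P [] → ∀ ys → xs *P ys ≈P [] → ys ≈P []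
        cancel []       []≉0 _ _ = ⊥-elim ([]≉0 []≈[])
        cancel (x ∷ xs) x∷xs≉0 ys e with x ≟ 0#
        ... | no x≉0  = cancel-lowest x≉0 xs ys e
        ... | yes x≈0 with ≈P-trans (+P-congʳ (shift (xs *P ys)) (≈P-sym (≈0⇒·≈[] ys x≈0))) e
        ...   | ∷≈[] _ xs*ys≈0 = cancel xs (λ xs≈0 → x∷xs≉0 (∷≈[] x≈0 xs≈0)) ys xs*ys≈0

      *P-noZeroDivisors : NoZeroDivisors +P-*P-commutativeRing
      *P-noZeroDivisors {xs} {ys} e with xs ≟P []
      ... | yes xs≈0 = inj₁ xs≈0
      ... | no xs≉0  = inj₂ (cancel xs xs≉0 ys e)

module FractionField
  (R : CommutativeRing 0ℓ 0ℓ) (1≉0 : Nontrivial R) (noZeroDivisors : NoZeroDivisors R) where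
  open CommutativeRing R
  open Fractions rawRing
  open NaturalSolver commutativeSemiring using (solve; _:=_; _:+_; _:*_)
  open RingProperties ring using (x[y-z]≈xy-xz; x∙y⁻¹≈ε⇒x≈y; -‿distribˡ-*)
  open SetoidReasoning setoid

  den : Frac → Carrier
  den p = prod (dens p)

  prod-++ : ∀ ds es → prod (ds ++ es) ≈ prod ds * prod es
  prod-++ []       es = sym (*-identityˡ _)
  prod-++ (d ∷ ds) es = trans (*-congˡ (prod-++ ds es)) (sym (*-assoc _ _ _))

  prod≉0 : ∀ ds → ¬ prod ds ≈ 0#
  prod≉0 []       = 1≉0
  prod≉0 (d ∷ ds) e with noZeroDivisors e
  ... | inj₁ d≈0  = proj₂ d d≈0
  ... | inj₂ ds≈0 = prod≉0 ds ds≈0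

  *-cancelˡ : ∀ {d x y} → ¬ d ≈ 0# → d * x ≈ d * y → x ≈ y
  *-cancelˡ {d} {x} {y} d≉0 e with noZeroDivisors {d} {x - y} (begin
      d * (x - y)       ≈⟨ x[y-z]≈xy-xz d x y ⟩
      d * x - d * y     ≈⟨ +-congʳ e ⟩
      d * y - d * y     ≈⟨ -‿inverseʳ _ ⟩
      0#                ∎)
  ... | inj₁ d≈0   = ⊥-elim (d≉0 d≈0)
  ... | inj₂ x-y≈0 = x∙y⁻¹≈ε⇒x≈y x y x-y≈0

  ++-prod : ∀ p r → prod (dens p ++ dens r) ≈ den p * den r
  ++-prod p r = prod-++ (dens p) (dens r)

  cross-resp : ∀ {n₁ n₂ d₁ d₂ n₁′ n₂′ d₁′ d₂′} → n₁ ≈ n₁′ → n₂ ≈ n₂′ → d₁ ≈ d₁′ → d₂ ≈ d₂′ →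
               n₁′ * d₂′ ≈ n₂′ * d₁′ → n₁ * d₂ ≈ n₂ * d₁
  cross-resp e₁ e₂ e₃ e₄ e = trans (*-cong e₁ e₄) (trans e (sym (*-cong e₂ e₃)))

  ≈F-trans : ∀ {p r s} → p ≈F r → r ≈F s → p ≈F s
  ≈F-trans {p} {r} {s} p≈r r≈s = *-cancelˡ (prod≉0 (dens r)) (begin
    den r * (num p * den s) ≈⟨ solve 3 (λ x y z → x :* (y :* z) := (y :* x) :* z) refl _ _ _ ⟩
    (num p * den r) * den s ≈⟨ *-congʳ p≈r ⟩
    (num r * den p) * den s ≈⟨ solve 3 (λ x y z → (x :* y) :* z := (x :* z) :* y) refl _ _ _ ⟩
    (num r * den s) * den p ≈⟨ *-congʳ r≈s ⟩
    (num s * den r) * den p ≈⟨ solve 3 (λ x y z → (x :* y) :* z := y :* (x :* z)) refl _ _ _ ⟩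
    den r * (num s * den p) ∎)

  +F-cong : ∀ {p p′ r r′} → p ≈F p′ → r ≈F r′ → p +F r ≈F p′ +F r′
  +F-cong {p} {p′} {r} {r′} p≈p′ r≈r′ = cross-resp refl refl (++-prod p r) (++-prod p′ r′) (begin
    (num p * den r + num r * den p) * (den p′ * den r′)
      ≈⟨ solve 6 (λ np dr nr dp dp′ dr′ → (np :* dr :+ nr :* dp) :* (dp′ :* dr′)
                   := (np :* dp′) :* (dr :* dr′) :+ (nr :* dr′) :* (dp :* dp′))
               refl (num p) (den r) (num r) (den p) (den p′) (den r′) ⟩
    (num p * den p′) * (den r * den r′) + (num r * den r′) * (den p * den p′)
      ≈⟨ +-cong (*-congʳ p≈p′) (*-congʳ r≈r′) ⟩
    (num p′ * den p) * (den r * den r′) + (num r′ * den r) * (den p * den p′)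
      ≈⟨ solve 6 (λ np′ dp dr dr′ nr′ dp′ → (np′ :* dp) :* (dr :* dr′) :+ (nr′ :* dr) :* (dp :* dp′)
                   := (np′ :* dr′ :+ nr′ :* dp′) :* (dp :* dr))
               refl (num p′) (den p) (den r) (den r′) (num r′) (den p′) ⟩
    (num p′ * den r′ + num r′ * den p′) * (den p * den r) ∎)

  +F-assoc : ∀ p r s → (p +F r) +F s ≈F p +F (r +F s)
  +F-assoc p r s = cross-resp
    (+-congˡ (*-congˡ (++-prod p r)))
    (+-congʳ (*-congˡ (++-prod r s)))
    (trans (prod-++ (dens p ++ dens r) (dens s)) (*-congʳ (++-prod p r)))
    (trans (prod-++ (dens p) (dens r ++ dens s)) (*-congˡ (++-prod r s)))
    (solve 6 (λ np dp nr dr ns ds →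
       ((np :* dr :+ nr :* dp) :* ds :+ ns :* (dp :* dr)) :* (dp :* (dr :* ds))
       := (np :* (dr :* ds) :+ (nr :* ds :+ ns :* dr) :* dp) :* ((dp :* dr) :* ds))
       refl (num p) (den p) (num r) (den r) (num s) (den s))

  +F-comm : ∀ p r → p +F r ≈F r +F p
  +F-comm p r = cross-resp refl refl (++-prod p r) (++-prod r p)
    (solve 4 (λ np dp nr dr → (np :* dr :+ nr :* dp) :* (dr :* dp) := (nr :* dp :+ np :* dr) :* (dp :* dr))
       refl (num p) (den p) (num r) (den r))

  +F-identityˡ : ∀ p → (0# / []) +F p ≈F p
  +F-identityˡ p = *-congʳ (trans (+-cong (zeroˡ _) (*-identityʳ _)) (+-identityˡ _))

  +F-identityʳ : ∀ p → p +F (0# / []) ≈F p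
  +F-identityʳ p = cross-resp (trans (+-cong (*-identityʳ _) (zeroˡ _)) (+-identityʳ _)) refl
    (trans (prod-++ (dens p) []) (*-identityʳ _)) refl refl

  -F-inverseˡ : ∀ p → (-F p) +F p ≈F (0# / [])
  -F-inverseˡ p = cross-resp (trans (+-congʳ (sym (-‿distribˡ-* _ _))) (-‿inverseˡ _)) refl refl refl
    (trans (zeroˡ _) (sym (zeroˡ _)))

  -F-inverseʳ : ∀ p → p +F (-F p) ≈F (0# / [])
  -F-inverseʳ p = cross-resp (trans (+-congˡ (sym (-‿distribˡ-* _ _))) (-‿inverseʳ _)) refl refl refl
    (trans (zeroˡ _) (sym (zeroˡ _)))

  -F-cong : ∀ {p r} → p ≈F r → -F p ≈F -F r
  -F-cong p≈r = trans (sym (-‿distribˡ-* _ _)) (trans (-‿cong p≈r) (-‿distribˡ-* _ _))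

  *F-cong : ∀ {p p′ r r′} → p ≈F p′ → r ≈F r′ → p *F r ≈F p′ *F r′
  *F-cong {p} {p′} {r} {r′} p≈p′ r≈r′ = cross-resp refl refl (++-prod p r) (++-prod p′ r′) (begin
    (num p * num r) * (den p′ * den r′)
      ≈⟨ solve 4 (λ np nr dp′ dr′ → (np :* nr) :* (dp′ :* dr′) := (np :* dp′) :* (nr :* dr′))
               refl (num p) (num r) (den p′) (den r′) ⟩
    (num p * den p′) * (num r * den r′) ≈⟨ *-cong p≈p′ r≈r′ ⟩
    (num p′ * den p) * (num r′ * den r)
      ≈⟨ solve 4 (λ np′ dp nr′ dr → (np′ :* dp) :* (nr′ :* dr) := (np′ :* nr′) :* (dp :* dr))
               refl (num p′) (den p) (num r′) (den r) ⟩
    (num p′ * num r′) * (den p * den r) ∎)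

  *F-assoc : ∀ p r s → (p *F r) *F s ≈F p *F (r *F s)
  *F-assoc p r s = cross-resp refl refl
    (trans (prod-++ (dens p ++ dens r) (dens s)) (*-congʳ (++-prod p r)))
    (trans (prod-++ (dens p) (dens r ++ dens s)) (*-congˡ (++-prod r s)))
    (solve 6 (λ np dp nr dr ns ds →
       ((np :* nr) :* ns) :* (dp :* (dr :* ds)) := (np :* (nr :* ns)) :* ((dp :* dr) :* ds))
       refl (num p) (den p) (num r) (den r) (num s) (den s))

  *F-comm : ∀ p r → p *F r ≈F r *F p
  *F-comm p r = cross-resp refl refl (++-prod p r) (++-prod r p)
    (solve 4 (λ np dp nr dr → (np :* nr) :* (dr :* dp) := (nr :* np) :* (dp :* dr))
       refl (num p) (den p) (num r) (den r))

  *F-identityˡ : ∀ p → (1# / []) *F p ≈F p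
  *F-identityˡ p = *-congʳ (*-identityˡ _)

  *F-identityʳ : ∀ p → p *F (1# / []) ≈F p
  *F-identityʳ p = cross-resp (*-identityʳ _) refl (trans (prod-++ (dens p) []) (*-identityʳ _)) refl refl

  *F-distribˡ : ∀ p r s → p *F (r +F s) ≈F (p *F r) +F (p *F s)
  *F-distribˡ p r s = cross-resp refl
    (+-cong (*-congˡ (++-prod p s)) (*-congˡ (++-prod p r)))
    (trans (prod-++ (dens p) (dens r ++ dens s)) (*-congˡ (++-prod r s)))
    (trans (prod-++ (dens p ++ dens r) (dens p ++ dens s)) (*-cong (++-prod p r) (++-prod p s)))
    (solve 6 (λ np dp nr dr ns ds →
       (np :* (nr :* ds :+ ns :* dr)) :* ((dp :* dr) :* (dp :* ds))
       := ((np :* nr) :* (dp :* ds) :+ (np :* ns) :* (dp :* dr)) :* (dp :* (dr :* ds)))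
       refl (num p) (den p) (num r) (den r) (num s) (den s))

  *F-distribʳ : ∀ p r s → (r +F s) *F p ≈F (r *F p) +F (s *F p)
  *F-distribʳ p r s = ≈F-trans {(r +F s) *F p} {p *F (r +F s)} {(r *F p) +F (s *F p)}
    (*F-comm (r +F s) p)
    (≈F-trans {p *F (r +F s)} {(p *F r) +F (p *F s)} {(r *F p) +F (s *F p)}
      (*F-distribˡ p r s) (+F-cong {p *F r} {r *F p} {p *F s} {s *F p} (*F-comm p r) (*F-comm p s)))

  +F-*F-isCommutativeRing : IsCommutativeRing _≈F_ _+F_ _*F_ -F_ (0# / []) (1# / [])
  +F-*F-isCommutativeRing = record
    { isRing = record
      { +-isAbelianGroup = record
        { isGroup = record
          { isMonoid = record
            { isSemigroup = record
              { isMagma = record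
                { isEquivalence = record
                  { refl = refl
                  ; sym = sym
                  ; trans = λ {p} {r} {s} → ≈F-trans {p} {r} {s} }
                ; ∙-cong = λ {p} {p′} {r} {r′} → +F-cong {p} {p′} {r} {r′} }
              ; assoc = +F-assoc }
            ; identity = +F-identityˡ , +F-identityʳ }
          ; inverse = -F-inverseˡ , -F-inverseʳ
          ; ⁻¹-cong = λ {p} {r} → -F-cong {p} {r} }
        ; comm = +F-comm }
      ; *-cong = λ {p} {p′} {r} {r′} → *F-cong {p} {p′} {r} {r′}
      ; *-assoc = *F-assoc
      ; *-identity = *F-identityˡ , *F-identityʳ
      ; distrib = *F-distribˡ , *F-distribʳ }
    ; *-comm = *F-comm }

  +F-*F-commutativeRing : CommutativeRing 0ℓ 0ℓ
  +F-*F-commutativeRing = record { isCommutativeRing = +F-*F-isCommutativeRing }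

  module _ (_≟_ : Decidable _≈_) where

    _≟F_ : Decidable _≈F_
    p ≟F r = (num p * den r) ≟ (num r * den p)

  _⁻¹ : (p : Frac) → ¬ num p ≈ 0# → Frac
  (p ⁻¹) p≉0 = den p / ((num p , p≉0) ∷ [])

  *F-inverseʳ : ∀ p (p≉0 : ¬ num p ≈ 0#) → p *F (p ⁻¹) p≉0 ≈F (1# / [])
  *F-inverseʳ p p≉0 = cross-resp refl refl (prod-++ (dens p) ((num p , p≉0) ∷ [])) refl
    (begin
      (num p * den p) * 1#        ≈⟨ *-identityʳ _ ⟩
      num p * den p               ≈⟨ *-comm _ _ ⟩
      den p * num p               ≈⟨ *-congˡ (*-identityʳ _) ⟨
      den p * (num p * 1#)        ≈⟨ *-identityˡ _ ⟨
      1# * (den p * (num p * 1#)) ∎)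

module Congruences {c ℓ} (R : CommutativeRing c ℓ) where
  open CommutativeRing R
  open RingProperties ring
    using (x[y-z]≈xy-xz; [y-z]x≈yx-zx; -‿distribˡ-*; -‿distribʳ-*; -‿+-comm; ⁻¹-anti-homo‿-; x≈y⇒x∙y⁻¹≈ε)
  open CommSemigroupProperties +-commutativeSemigroup using (interchange)
  open NaturalSolver commutativeSemiring using (solve; _:=_; _:+_; _:*_)
  open SetoidReasoning setoid

  infix 4 _∣_ _∼_ _≡_[mod_]

  _∣_ : Carrier → Carrier → Set (c ⊔ ℓ)
  d ∣ f = Σ Carrier (λ h → f ≈ d * h)

  IsUnit : Carrier → Set (c ⊔ ℓ)
  IsUnit u = u ∣ 1#

  RelPrime : Carrier → Carrier → Set (c ⊔ ℓ)
  RelPrime f g = (d : Carrier) → d ∣ f → d ∣ g → IsUnit d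

  _≡_[mod_] : Carrier → Carrier → Carrier → Set (c ⊔ ℓ)
  f ≡ f′ [mod d ] = d ∣ (f - f′)

  -- Comaximality (a Bézout identity); unlike RelPrime it is easily seen to be preserved by products.
  Coprime : Carrier → Carrier → Set (c ⊔ ℓ)
  Coprime f g = Σ Carrier λ s → Σ Carrier λ t → s * f + t * g ≈ 1#

  _∼_ : Carrier → Carrier → Set (c ⊔ ℓ)
  d ∼ d′ = Σ Carrier λ u → IsUnit u × d ≈ u * d′

  ∣-respʳ : ∀ {d f f′} → f ≈ f′ → d ∣ f → d ∣ f′
  ∣-respʳ f≈f′ (h , f≈dh) = h , trans (sym f≈f′) f≈dh

  ∣-+ : ∀ {d f g} → d ∣ f → d ∣ g → d ∣ f + g
  ∣-+ {d} (h , f≈dh) (k , g≈dk) = h + k , trans (+-cong f≈dh g≈dk) (sym (distribˡ d h k))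

  ∣-neg : ∀ {d f} → d ∣ f → d ∣ - f
  ∣-neg {d} (h , f≈dh) = - h , trans (-‿cong f≈dh) (-‿distribʳ-* d h)

  ∣-*ʳ : ∀ {d f} g → d ∣ f → d ∣ f * g
  ∣-*ʳ {d} g (h , f≈dh) = h * g , trans (*-congʳ f≈dh) (*-assoc d h g)

  ∣-*ˡ : ∀ {d f} g → d ∣ f → d ∣ g * f
  ∣-*ˡ {f = f} g d∣f = ∣-respʳ (*-comm f g) (∣-*ʳ g d∣f)

  telescope : ∀ x y z → (x - y) + (y - z) ≈ x - z
  telescope x y z = begin
    (x - y) + (y - z)     ≈⟨ +-assoc x (- y) (y - z) ⟩
    x + (- y + (y - z))   ≈⟨ +-congˡ (+-assoc (- y) y (- z)) ⟨
    x + ((- y + y) - z)   ≈⟨ +-congˡ (+-congʳ (-‿inverseˡ y)) ⟩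
    x + (0# - z)          ≈⟨ +-congˡ (+-identityˡ (- z)) ⟩
    x - z                 ∎

  ≡-reflexive : ∀ {d f f′} → f ≈ f′ → f ≡ f′ [mod d ]
  ≡-reflexive {d} f≈f′ = 0# , trans (x≈y⇒x∙y⁻¹≈ε f≈f′) (sym (zeroʳ d))

  ≡-trans : ∀ {d f g h} → f ≡ g [mod d ] → g ≡ h [mod d ] → f ≡ h [mod d ]
  ≡-trans {f = f} {g} {h} f≡g g≡h = ∣-respʳ (telescope f g h) (∣-+ f≡g g≡h)

  ≡-+ : ∀ {d f f′ g g′} → f ≡ f′ [mod d ] → g ≡ g′ [mod d ] → f + g ≡ f′ + g′ [mod d ]
  ≡-+ {f = f} {f′} {g} {g′} f≡f′ g≡g′ = ∣-respʳ (begin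
    (f - f′) + (g - g′)       ≈⟨ interchange f (- f′) g (- g′) ⟩
    (f + g) + (- f′ + - g′)   ≈⟨ +-congˡ (-‿+-comm f′ g′) ⟩
    (f + g) - (f′ + g′)       ∎) (∣-+ f≡f′ g≡g′)

  ≡-neg : ∀ {d f f′} → f ≡ f′ [mod d ] → - f ≡ - f′ [mod d ]
  ≡-neg {f = f} {f′} f≡f′ = ∣-respʳ (sym (-‿+-comm f (- f′))) (∣-neg f≡f′)

  ≡-* : ∀ {d f f′ g g′} → f ≡ f′ [mod d ] → g ≡ g′ [mod d ] → f * g ≡ f′ * g′ [mod d ]
  ≡-* {f = f} {f′} {g} {g′} f≡f′ g≡g′ = ≡-trans
    (∣-respʳ ([y-z]x≈yx-zx g f f′) (∣-*ʳ g f≡f′))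
    (∣-respʳ (x[y-z]≈xy-xz f′ g g′) (∣-*ˡ f′ g≡g′))

  ∼-refl : ∀ {d} → d ∼ d
  ∼-refl {d} = 1# , (1# , sym (*-identityˡ 1#)) , sym (*-identityˡ d)

  1-ug∼r-g : ∀ u r g → u * r ≈ 1# → 1# - u * g ∼ r - g
  1-ug∼r-g u r g ur≈1 = u , (r , sym ur≈1) , (begin
    1# - u * g      ≈⟨ +-congʳ ur≈1 ⟨
    u * r - u * g   ≈⟨ x[y-z]≈xy-xz u r g ⟨
    u * (r - g)     ∎)

  unit-*-cancel : ∀ {u v} x y → 1# ≈ u * v → (u * x) * (v * y) ≈ x * y
  unit-*-cancel {u} {v} x y 1≈uv = begin
    (u * x) * (v * y) ≈⟨ solve 4 (λ u v x y → (u :* x) :* (v :* y) := (u :* v) :* (x :* y)) refl u v x y ⟩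
    (u * v) * (x * y) ≈⟨ *-congʳ 1≈uv ⟨
    1# * (x * y)      ≈⟨ *-identityˡ (x * y) ⟩
    x * y             ∎

  ≡-∼ : ∀ {d d′ f f′} → d ∼ d′ → f ≡ f′ [mod d′ ] → f ≡ f′ [mod d ]
  ≡-∼ {d} {d′} {f} {f′} (u , (v , 1≈uv) , d≈ud′) (h , f-f′≈d′h) = v * h , (begin
    f - f′             ≈⟨ f-f′≈d′h ⟩
    d′ * h             ≈⟨ unit-*-cancel d′ h 1≈uv ⟨
    (u * d′) * (v * h) ≈⟨ *-congʳ d≈ud′ ⟨
    d * (v * h)        ∎)

  ≡-mod-* : ∀ {d e f f′} → Coprime d e → f ≡ f′ [mod d ] → f ≡ f′ [mod e ] → f ≡ f′ [mod d * e ]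
  ≡-mod-* {d} {e} {f} {f′} (s , t , sd+te≈1) (h , f-f′≈dh) (k , f-f′≈ek) = s * k + t * h , (begin
    f - f′                              ≈⟨ *-identityˡ (f - f′) ⟨
    1# * (f - f′)                       ≈⟨ *-congʳ sd+te≈1 ⟨
    (s * d + t * e) * (f - f′)          ≈⟨ distribʳ (f - f′) (s * d) (t * e) ⟩
    s * d * (f - f′) + t * e * (f - f′) ≈⟨ +-cong (*-congˡ f-f′≈ek) (*-congˡ f-f′≈dh) ⟩
    s * d * (e * k) + t * e * (d * h)
      ≈⟨ solve 6 (λ s t d e h k → s :* d :* (e :* k) :+ t :* e :* (d :* h) := d :* e :* (s :* k :+ t :* h))
               refl s t d e h k ⟩
    d * e * (s * k + t * h)             ∎)

  coprime⇒relPrime : ∀ {f g} → Coprime f g → RelPrime f g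
  coprime⇒relPrime {f} {g} (s , t , sf+tg≈1) d (h , f≈dh) (k , g≈dk) = s * h + t * k , (begin
    1#                    ≈⟨ sf+tg≈1 ⟨
    s * f + t * g         ≈⟨ +-cong (*-congˡ f≈dh) (*-congˡ g≈dk) ⟩
    s * (d * h) + t * (d * k)
      ≈⟨ solve 5 (λ s t d h k → s :* (d :* h) :+ t :* (d :* k) := d :* (s :* h :+ t :* k)) refl s t d h k ⟩
    d * (s * h + t * k)   ∎)

  coprime-sym : ∀ {f g} → Coprime f g → Coprime g f
  coprime-sym (s , t , sf+tg≈1) = t , s , trans (+-comm _ _) sf+tg≈1

  coprime-*ʳ : ∀ {f g h} → Coprime f g → Coprime f h → Coprime f (g * h)
  coprime-*ʳ {f} {g} {h} (s , t , sf+tg≈1) (s′ , t′ , s′f+t′h≈1) =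
    s * s′ * f + s * t′ * h + t * s′ * g , t * t′ , (begin
      (s * s′ * f + s * t′ * h + t * s′ * g) * f + t * t′ * (g * h)
        ≈⟨ solve 7 (λ s t s′ t′ f g h →
                      (s :* s′ :* f :+ s :* t′ :* h :+ t :* s′ :* g) :* f :+ t :* t′ :* (g :* h)
                      := (s :* f :+ t :* g) :* (s′ :* f :+ t′ :* h))
                 refl s t s′ t′ f g h ⟩
      (s * f + t * g) * (s′ * f + t′ * h) ≈⟨ *-cong sf+tg≈1 s′f+t′h≈1 ⟩
      1# * 1#                             ≈⟨ *-identityˡ 1# ⟩
      1#                                  ∎)

  coprime-*ˡ : ∀ {f g h} → Coprime f h → Coprime g h → Coprime (f * g) h
  coprime-*ˡ f⊥h g⊥h = coprime-sym (coprime-*ʳ (coprime-sym f⊥h) (coprime-sym g⊥h))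

  coprime-∼ˡ : ∀ {d d′ e} → d ∼ d′ → Coprime d′ e → Coprime d e
  coprime-∼ˡ {d} {d′} {e} (u , (v , 1≈uv) , d≈ud′) (s , t , sd′+te≈1) = v * s , t , (begin
    v * s * d + t * e          ≈⟨ +-congʳ (*-congˡ d≈ud′) ⟩
    v * s * (u * d′) + t * e   ≈⟨ +-congʳ (*-comm (v * s) (u * d′)) ⟩
    u * d′ * (v * s) + t * e   ≈⟨ +-congʳ (unit-*-cancel d′ s 1≈uv) ⟩
    d′ * s + t * e             ≈⟨ +-congʳ (*-comm d′ s) ⟩
    s * d′ + t * e             ≈⟨ sd′+te≈1 ⟩
    1#                         ∎)

  coprime-linear : ∀ {r s} g → IsUnit (r - s) → Coprime (r - g) (s - g)
  coprime-linear {r} {s} g (w , 1≈[r-s]w) = w , - w , (begin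
    w * (r - g) + - w * (s - g)     ≈⟨ +-congˡ (-‿distribˡ-* w (s - g)) ⟨
    w * (r - g) + - (w * (s - g))   ≈⟨ +-congˡ (-‿distribʳ-* w (s - g)) ⟩
    w * (r - g) + w * - (s - g)     ≈⟨ +-congˡ (*-congˡ (⁻¹-anti-homo‿- s g)) ⟩
    w * (r - g) + w * (g - s)       ≈⟨ distribˡ w (r - g) (g - s) ⟨
    w * ((r - g) + (g - s))         ≈⟨ *-congˡ (telescope r g s) ⟩
    w * (r - s)                     ≈⟨ *-comm w (r - s) ⟩
    (r - s) * w                     ≈⟨ 1≈[r-s]w ⟨
    1#                              ∎)

  record LinearFactor (x : Carrier) : Set (c ⊔ ℓ) where
    constructor linearFactor
    field
      factor        : Carrier
      root          : Carrier
      factor∼root-x : factor ∼ root - x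

  open LinearFactor public

  coprime-roots : ∀ {x} (d e : LinearFactor x) → IsUnit (root d - root e) → Coprime (factor d) (factor e)
  coprime-roots {x} d e unit = coprime-∼ˡ (factor∼root-x d)
    (coprime-sym (coprime-∼ˡ (factor∼root-x e) (coprime-sym (coprime-linear x unit))))

module PolynomialExpressions {c ℓ} (R : CommutativeRing c ℓ) where
  open CommutativeRing R
  open RingProperties ring using (-‿distribʳ-*; ⁻¹-anti-homo‿-)
  open Congruences R
  open SetoidReasoning setoid

  infixl 6 _:+_ _:-_
  infixl 7 _:*_

  data Expr : Set c where
    var           : Expr
    con           : Carrier → Expr
    _:+_ _:-_ _:*_ : Expr → Expr → Expr

  ⟦_⟧ : Expr → Carrier → Carrier
  ⟦ var    ⟧ g = g
  ⟦ con k  ⟧ g = k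
  ⟦ e :+ f ⟧ g = ⟦ e ⟧ g + ⟦ f ⟧ g
  ⟦ e :- f ⟧ g = ⟦ e ⟧ g - ⟦ f ⟧ g
  ⟦ e :* f ⟧ g = ⟦ e ⟧ g * ⟦ f ⟧ g

  x≡r[mod-r-x] : ∀ x r → x ≡ r [mod r - x ]
  x≡r[mod-r-x] x r = - 1# , (begin
    x - r                ≈⟨ ⁻¹-anti-homo‿- r x ⟨
    - (r - x)            ≈⟨ -‿cong (*-identityʳ (r - x)) ⟨
    - ((r - x) * 1#)     ≈⟨ -‿distribʳ-* (r - x) 1# ⟩
    (r - x) * - 1#       ∎)

  remainder-theorem : ∀ e x r → ⟦ e ⟧ x ≡ ⟦ e ⟧ r [mod r - x ]
  remainder-theorem var      x r = x≡r[mod-r-x] x r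
  remainder-theorem (con k)  x r = ≡-reflexive refl
  remainder-theorem (e :+ f) x r = ≡-+ (remainder-theorem e x r) (remainder-theorem f x r)
  remainder-theorem (e :- f) x r = ≡-+ (remainder-theorem e x r) (≡-neg (remainder-theorem f x r))
  remainder-theorem (e :* f) x r = ≡-* (remainder-theorem e x r) (remainder-theorem f x r)

  ≡-at-root : ∀ {x v} (d : LinearFactor x) f → ⟦ f ⟧ (root d) ≈ v → ⟦ f ⟧ x ≡ v [mod factor d ]
  ≡-at-root {x} d f f[r]≈v =
    ≡-∼ (factor∼root-x d) (≡-trans (remainder-theorem f x (root d)) (≡-reflexive f[r]≈v))

  ≡-at-roots : ∀ {x v} (d e : LinearFactor x) → IsUnit (root d - root e) →
               ∀ f → ⟦ f ⟧ (root d) ≈ v → ⟦ f ⟧ (root e) ≈ v → ⟦ f ⟧ x ≡ v [mod factor d * factor e ]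
  ≡-at-roots d e unit f f[r]≈v f[s]≈v =
    ≡-mod-* (coprime-roots d e unit) (≡-at-root d f f[r]≈v) (≡-at-root e f f[s]≈v)

open import Defs

module Zcₚ  = Polynomials ℤ.+-*-commutativeRing
module Zbcₚ = Polynomials Zcₚ.+P-*P-commutativeRing
module Z3ₚ  = Polynomials Zbcₚ.+P-*P-commutativeRing

ℤ[a,b,c]-ring : CommutativeRing 0ℓ 0ℓ
ℤ[a,b,c]-ring = Z3ₚ.+P-*P-commutativeRing

ℤ[a,b,c]-noZeroDivisors : NoZeroDivisors ℤ[a,b,c]-ring
ℤ[a,b,c]-noZeroDivisors =
  Z3ₚ.*P-noZeroDivisors (Zbcₚ._≟P_ (Zcₚ._≟P_ ℤ._≟_))
    (Zbcₚ.*P-noZeroDivisors (Zcₚ._≟P_ ℤ._≟_)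
      (Zcₚ.*P-noZeroDivisors ℤ._≟_ (ℤ.i*j≡0⇒i≡0∨j≡0 _)))

ℤ[a,b,c]-nontrivial : Nontrivial ℤ[a,b,c]-ring
ℤ[a,b,c]-nontrivial (Z3.∷≈[] (Zbc.∷≈[] (Zc.∷≈[] () _) _) _)

module Kₚ  = FractionField ℤ[a,b,c]-ring ℤ[a,b,c]-nontrivial ℤ[a,b,c]-noZeroDivisors
module Kqₚ = Polynomials Kₚ.+F-*F-commutativeRing

infix 4 _≟_
_≟_ : Decidable _≈q_
_≟_ = Kqₚ._≟P_ (Kₚ._≟F_ (Z3ₚ._≟P_ (Zbcₚ._≟P_ (Zcₚ._≟P_ ℤ._≟_))))

open Congruences Kqₚ.+P-*P-commutativeRing
  using (Coprime; LinearFactor; linearFactor; ∼-refl; 1-ug∼r-g; coprime⇒relPrime; coprime-*ˡ; coprime-*ʳ;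
         coprime-roots)
open PolynomialExpressions Kqₚ.+P-*P-commutativeRing
  using (Expr; var; con; _:+_; _:-_; _:*_; ⟦_⟧; ≡-at-root; ≡-at-roots)

IsNonzeroConstant : K[q] → Set
IsNonzeroConstant (k ∷ []) = False (decZ3 (FK.num k))
IsNonzeroConstant _        = ⊥

nonzero-constant-isUnit : ∀ p {_ : IsNonzeroConstant p} → IsUnit p
nonzero-constant-isUnit (k ∷ []) {k≉0} =
  Kq.const k⁻¹ , Kqₚ.1≈const-* k k⁻¹ (Kₚ.*F-inverseʳ k (toWitnessFalse k≉0))
  where
  k⁻¹ : FK.Frac
  k⁻¹ = (k Kₚ.⁻¹) (toWitnessFalse k≉0)

a⁻¹ [bc]⁻¹ : K[q]
a⁻¹    = inv (nz! za ∷ [])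
[bc]⁻¹ = inv (nz! zb ∷ nz! zc ∷ [])

a*a⁻¹≈1 : a ⊗ a⁻¹ ≈q 𝟙
a*a⁻¹≈1 = from-yes (a ⊗ a⁻¹ ≟ 𝟙)

bc*[bc]⁻¹≈1 : b ⊗ c ⊗ [bc]⁻¹ ≈q 𝟙
bc*[bc]⁻¹≈1 = from-yes (b ⊗ c ⊗ [bc]⁻¹ ≟ 𝟙)

-- ⟦ Pᵢᵉ ⟧ Q and ⟦ Lᵢ ⟧ Q unfold to Pᵢ and to the i-th left-hand side of the statement,
-- with q ^ n replaced by Q.
P₁ᵉ P₂ᵉ P₃ᵉ L₁ L₂ L₃ : Expr
P₁ᵉ = (con a :- var) :* (con 𝟙 :- con a :* var)
P₂ᵉ = (con b :- var) :* (con 𝟙 :- con (b ⊗ c) :* var)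
P₃ᵉ = con c :- var
L₁  = P₂ᵉ :* P₃ᵉ :* (con x :- con y :* var) :* con (inv dens₁)
L₂  = P₁ᵉ :* P₃ᵉ :* (con u :- con v :* var) :* con (inv dens₂)
L₃  = P₁ᵉ :* P₂ᵉ :* con (inv dens₃)

L₁[a]≈1 : ⟦ L₁ ⟧ a ≈q 𝟙
L₁[a]≈1 = from-yes (⟦ L₁ ⟧ a ≟ 𝟙)

L₁[a⁻¹]≈1 : ⟦ L₁ ⟧ a⁻¹ ≈q 𝟙
L₁[a⁻¹]≈1 = from-yes (⟦ L₁ ⟧ a⁻¹ ≟ 𝟙)

L₂[b]≈1 : ⟦ L₂ ⟧ b ≈q 𝟙
L₂[b]≈1 = from-yes (⟦ L₂ ⟧ b ≟ 𝟙)

L₂[[bc]⁻¹]≈1 : ⟦ L₂ ⟧ [bc]⁻¹ ≈q 𝟙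
L₂[[bc]⁻¹]≈1 = from-yes (⟦ L₂ ⟧ [bc]⁻¹ ≟ 𝟙)

L₃[c]≈1 : ⟦ L₃ ⟧ c ≈q 𝟙
L₃[c]≈1 = from-yes (⟦ L₃ ⟧ c ≟ 𝟙)

module _ (Q : K[q]) where

  a-Q 1-aQ b-Q 1-bcQ c-Q : LinearFactor Q
  a-Q   = linearFactor (a ⊝ Q) a ∼-refl
  1-aQ  = linearFactor (𝟙 ⊝ a ⊗ Q) a⁻¹ (1-ug∼r-g a a⁻¹ Q a*a⁻¹≈1)
  b-Q   = linearFactor (b ⊝ Q) b ∼-refl
  1-bcQ = linearFactor (𝟙 ⊝ b ⊗ c ⊗ Q) [bc]⁻¹ (1-ug∼r-g (b ⊗ c) [bc]⁻¹ Q bc*[bc]⁻¹≈1)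
  c-Q   = linearFactor (c ⊝ Q) c ∼-refl

  P₁⊥P₂ : Coprime (⟦ P₁ᵉ ⟧ Q) (⟦ P₂ᵉ ⟧ Q)
  P₁⊥P₂ = coprime-*ˡ
    (coprime-*ʳ (coprime-roots a-Q b-Q (nonzero-constant-isUnit (a ⊝ b)))
                (coprime-roots a-Q 1-bcQ (nonzero-constant-isUnit (a ⊝ [bc]⁻¹))))
    (coprime-*ʳ (coprime-roots 1-aQ b-Q (nonzero-constant-isUnit (a⁻¹ ⊝ b)))
                (coprime-roots 1-aQ 1-bcQ (nonzero-constant-isUnit (a⁻¹ ⊝ [bc]⁻¹))))

  P₁⊥P₃ : Coprime (⟦ P₁ᵉ ⟧ Q) (⟦ P₃ᵉ ⟧ Q)
  P₁⊥P₃ = coprime-*ˡ (coprime-roots a-Q c-Q (nonzero-constant-isUnit (a ⊝ c)))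
                     (coprime-roots 1-aQ c-Q (nonzero-constant-isUnit (a⁻¹ ⊝ c)))

  P₂⊥P₃ : Coprime (⟦ P₂ᵉ ⟧ Q) (⟦ P₃ᵉ ⟧ Q)
  P₂⊥P₃ = coprime-*ˡ (coprime-roots b-Q c-Q (nonzero-constant-isUnit (b ⊝ c)))
                     (coprime-roots 1-bcQ c-Q (nonzero-constant-isUnit ([bc]⁻¹ ⊝ c)))

  L₁≡1 : ⟦ L₁ ⟧ Q ≡ 𝟙 [mod ⟦ P₁ᵉ ⟧ Q ]
  L₁≡1 = ≡-at-roots a-Q 1-aQ (nonzero-constant-isUnit (a ⊝ a⁻¹)) L₁ L₁[a]≈1 L₁[a⁻¹]≈1

  L₂≡1 : ⟦ L₂ ⟧ Q ≡ 𝟙 [mod ⟦ P₂ᵉ ⟧ Q ]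
  L₂≡1 = ≡-at-roots b-Q 1-bcQ (nonzero-constant-isUnit (b ⊝ [bc]⁻¹)) L₂ L₂[b]≈1 L₂[[bc]⁻¹]≈1

  L₃≡1 : ⟦ L₃ ⟧ Q ≡ 𝟙 [mod ⟦ P₃ᵉ ⟧ Q ]
  L₃≡1 = ≡-at-root c-Q L₃ L₃[c]≈1

-- The argument works for any Q in place of q ^ n.
lemma2p2 : (n : ℕ) → 1 ≤ n →
    let P₁ = (a ⊝ q ^ n) ⊗ (𝟙 ⊝ a ⊗ q ^ n)
        P₂ = (b ⊝ q ^ n) ⊗ (𝟙 ⊝ b ⊗ c ⊗ q ^ n)
        P₃ = c ⊝ q ^ n
    in RelPrime P₁ P₂ × RelPrime P₁ P₃ × RelPrime P₂ P₃
       × (P₂ ⊗ P₃ ⊗ (x ⊝ y ⊗ q ^ n) ⊗ inv dens₁ ≡ 𝟙 [mod P₁ ])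
       × (P₁ ⊗ P₃ ⊗ (u ⊝ v ⊗ q ^ n) ⊗ inv dens₂ ≡ 𝟙 [mod P₂ ])
       × (P₁ ⊗ P₂ ⊗ inv dens₃ ≡ 𝟙 [mod P₃ ])
lemma2p2 n _ =
    coprime⇒relPrime (P₁⊥P₂ Q) , coprime⇒relPrime (P₁⊥P₃ Q) , coprime⇒relPrime (P₂⊥P₃ Q)
  , L₁≡1 Q , L₂≡1 Q , L₃≡1 Q
  where
  Q : K[q]
  Q = q ^ n
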